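{- Let $T\in\binom{[n]}{k}$ with $1\notin T$ (so that $M=\langle T\rangle$ is a coloopless shifted matroid of rank $k$). If $T$ has exactly three blocks and the second block of $T$ has size one, then $M$ is threshold.
   Context: For $T\in\binom{[n]}{k}$, $\langle T\rangle$ is the matroid on $[n]$ whose bases are the $k$-subsets $\{s_1<\dots<s_k\}$ with $s_i\le t_i$ for all $i$, where $T=\{t_1<\dots<t_k\}$. Blocks: $T$, written as an increasing word, decomposes uniquely as a concatenation $T_1\cdots T_\ell$ of inclusion-maximal runs of consecutive integers; $T_i$ is the $i$-th block. A rank $k$ matroid on $E$ is threshold if there is $w:E\to\mathbb{R}$ such that a $k$-subset $B$ is a basis iff $\sum_{b\in B}w(b)>0$. -}

module Defs where

open import Data.Nat using (ℕ; zero; suc; _≤_; _<_; _≡ᵇ_)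
open import Data.Bool using (if_then_else_)
open import Data.List using (List; []; _∷_; length; foldr)
open import Data.List.Relation.Unary.All using (All)
open import Data.List.Relation.Unary.Linked using (Linked)
open import Data.List.Relation.Binary.Pointwise using (Pointwise)
open import Data.Product using (Σ; _×_)
open import Relation.Binary.PropositionalEquality using (_≡_)
open import Function.Bundles using (_⇔_)
import Data.Rational as ℚ
open ℚ using (ℚ)

-- Ground set [n] = {1,…,n}.  A subset of [n] is represented as a strictly
-- increasing list of its elements (so the i-th entry is s_i).
InRange : ℕ → ℕ → Set
InRange n x = 1 ≤ x × x ≤ n

KSubset : ℕ → ℕ → List ℕ → Set
KSubset n k S = Linked _<_ S × All (InRange n) S × length S ≡ k

IsBasisOfShifted : (n k : ℕ) → List ℕ → List ℕ → Set
IsBasisOfShifted n k T S = KSubset n k S × Pointwise _≤_ S T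

weight : (ℕ → ℚ) → List ℕ → ℚ
weight w B = foldr (λ b acc → w b ℚ.+ acc) ℚ.0ℚ B

IsThreshold : (n k : ℕ) → (List ℕ → Set) → Set
IsThreshold n k IsBasis =
  Σ (ℕ → ℚ) λ w → ∀ B → KSubset n k B → (IsBasis B ⇔ (ℚ.0ℚ ℚ.< weight w B))

private
  consBlock : ℕ → List (List ℕ) → List (List ℕ)
  consBlock x [] = (x ∷ []) ∷ []
  consBlock x ([] ∷ bs) = (x ∷ []) ∷ [] ∷ bs
  consBlock x ((y ∷ b) ∷ bs) =
    if suc x ≡ᵇ y then (x ∷ y ∷ b) ∷ bs else (x ∷ []) ∷ (y ∷ b) ∷ bs

blocks : List ℕ → List (List ℕ)
blocks [] = []
blocks (x ∷ xs) = consBlock x (blocks xs)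

{-# OPTIONS --safe #-}
module Submission where

-- For sorted lists, being bounded entrywise by a run a, a + 1, …, a + p − 1 is a condition
-- on how many entries lie below a + p − 1.  Hence a k-subset B is a basis of ⟨A c D⟩ (A and D
-- runs, c a single element) iff, with X ≤ Y ≤ Z ≤ k the numbers of elements of B that are
-- ≤ max A, ≤ c and ≤ max D, we have X ≥ |A|, Y > |A| and Z = k.  With P = |A| and
-- M = k (k + 1) this is the single inequality (k − 1) X + Y + M Z > k P + M k: a deficit in Z
-- costs at least M, more than (k − 1) X + Y ≤ M can make up, and for Z = k the inequality fails
-- exactly when X < P or X = Y = P.  Spreading the constant k (P + M) evenly over the k elements
-- of B turns the left side minus the right side into a sum of per-element weights.

open import Defs
open import Data.Bool as Bool using (true; false)
open import Data.Empty using (⊥-elim)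
open import Data.Integer as ℤ using (ℤ; _⊖_)
import Data.Integer.Properties as ℤₚ
import Data.Integer.Tactic.RingSolver as ℤ-Solver
open import Data.List using (List; []; _∷_; length; map; _++_; drop; concat)
open import Data.List.Properties using (map-++; length-++; length-drop; drop-all; ++-identityʳ)
open import Data.List.Membership.Propositional using (_∈_)
open import Data.List.Relation.Unary.All as All using (All; []; _∷_)
import Data.List.Relation.Unary.All.Properties as All
open import Data.List.Relation.Unary.Linked as Linked using (Linked; [])
open import Data.List.Relation.Unary.Linked.Properties using (Linked⇒All)
open import Data.List.Relation.Binary.Pointwise using (Pointwise; []; _∷_)
open import Data.Nat
open import Data.Nat.Properties
open import Data.Nat.ListAction using (sum)
open import Data.Nat.ListAction.Properties using (sum-++)
open import Algebra.Properties.CommutativeSemigroup +-commutativeSemigroup using (interchange)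
open import Data.Nat.Coprimality as Coprime using (1-coprimeTo)
open import Data.Nat.Tactic.RingSolver using (solve-∀)
open import Data.Product using (Σ; ∃₂; _×_; _,_)
import Data.Rational as ℚ
open ℚ using (ℚ; mkℚ)
import Data.Rational.Properties as ℚₚ
import Data.Rational.Unnormalised as ℚᵘ
import Data.Rational.Unnormalised.Properties as ℚᵘₚ
open import Function.Base using (_⟨_⟩_)
open import Function.Bundles using (_⇔_; mk⇔)
import Function.Properties.Equivalence as ⇔
open import Relation.Binary.PropositionalEquality
  using (_≡_; refl; sym; trans; cong; cong₂; subst; module ≡-Reasoning)
open import Relation.Nullary using (¬_; yes; no)

run : ℕ → ℕ → List ℕ
run a zero    = []
run a (suc p) = a ∷ run (suc a) p

IsRun : List ℕ → Set
IsRun B = ∃₂ λ a p → B ≡ run a (suc p)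

length-run : ∀ a p → length (run a p) ≡ p
length-run a zero    = refl
length-run a (suc p) = cong suc (length-run (suc a) p)

concat-blocks : ∀ T → concat (blocks T) ≡ T
concat-blocks []       = refl
concat-blocks (x ∷ xs) with blocks xs | concat-blocks xs
... | []           | eq = cong (x ∷_) eq
... | [] ∷ _       | eq = cong (x ∷_) eq
... | (y ∷ _) ∷ _  | eq with suc x ≡ᵇ y
...   | true  = cong (x ∷_) eq
...   | false = cong (x ∷_) eq

blocks-runs : ∀ T → All IsRun (blocks T)
blocks-runs []       = []
blocks-runs (x ∷ xs) with blocks xs | blocks-runs xs
... | []          | []                   = (x , 0 , refl) ∷ []
... | [] ∷ _      | (_ , _ , ()) ∷ _
... | (_ ∷ _) ∷ _ | (a , p , refl) ∷ rs with suc x ≡ᵇ a in eq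
...   | false = (x , 0 , refl) ∷ (a , p , refl) ∷ rs
...   | true with ≡ᵇ⇒≡ (suc x) a (subst Bool.T (sym eq) _)
...     | refl = (x , suc p , refl) ∷ rs

three-blocks-shape : ∀ {T B₁ B₂ B₃} → blocks T ≡ B₁ ∷ B₂ ∷ B₃ ∷ [] → length B₂ ≡ 1
                   → Σ ℕ λ a → Σ ℕ λ p → Σ ℕ λ c → Σ ℕ λ d → Σ ℕ λ q →
                       T ≡ run a (suc p) ++ run c 1 ++ run d (suc q)
three-blocks-shape {T} blocks≡ |B₂| with subst (All IsRun) blocks≡ (blocks-runs T)
... | (a , p , refl) ∷ (c , r , refl) ∷ (d , q , refl) ∷ []
  with suc-injective (trans (sym (length-run c (suc r))) |B₂|)
... | refl = a , p , c , d , q , (begin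
  T                                                    ≡⟨ concat-blocks T ⟨
  concat (blocks T)                                    ≡⟨ cong concat blocks≡ ⟩
  run a (suc p) ++ run c 1 ++ run d (suc q) ++ []      ≡⟨ cong (λ R → run a (suc p) ++ run c 1 ++ R) (++-identityʳ _) ⟩
  run a (suc p) ++ run c 1 ++ run d (suc q)            ∎)
  where open ≡-Reasoning

run-≤-end : ∀ a p → All (_≤ a + p) (run a (suc p))
run-≤-end a zero    = ≤-reflexive (sym (+-identityʳ a)) ∷ []
run-≤-end a (suc p) =
  m≤m+n a (suc p) ∷ subst (λ e → All (_≤ e) (run (suc a) (suc p))) (sym (+-suc a p)) (run-≤-end (suc a) p)

run-++-end< : ∀ a p {y ys} → Linked _<_ (run a (suc p) ++ y ∷ ys) → a + p < y
run-++-end< a zero    {y} sorted = subst (_< y) (sym (+-identityʳ a)) (Linked.head sorted)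
run-++-end< a (suc p) {y} sorted = subst (_< y) (sym (+-suc a p)) (run-++-end< (suc a) p (Linked.tail sorted))

Linked-++⁻ʳ : ∀ {A : Set} {R : A → A → Set} xs {ys} → Linked R (xs ++ ys) → Linked R ys
Linked-++⁻ʳ []       sorted = sorted
Linked-++⁻ʳ (_ ∷ xs) sorted = Linked-++⁻ʳ xs (Linked.tail sorted)

Linked-drop : ∀ {A : Set} {R : A → A → Set} m {xs} → Linked R xs → Linked R (drop m xs)
Linked-drop zero    sorted          = sorted
Linked-drop (suc m) {[]}    _       = []
Linked-drop (suc m) {_ ∷ _} sorted  = Linked-drop m (Linked.tail sorted)

[_≤_] : ℕ → ℕ → ℕ
[ s ≤ x ] with s ≤? x
... | yes _ = 1
... | no  _ = 0

count≤ : ℕ → List ℕ → ℕ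
count≤ x S = sum (map [_≤ x ] S)

[≤]≤1 : ∀ s x → [ s ≤ x ] ≤ 1
[≤]≤1 s x with s ≤? x
... | yes _ = ≤-refl
... | no  _ = z≤n

count≤-∷ : ∀ x s S → count≤ x (s ∷ S) ≤ suc (count≤ x S)
count≤-∷ x s S = +-monoˡ-≤ (count≤ x S) ([≤]≤1 s x)

count≤≤length : ∀ x S → count≤ x S ≤ length S
count≤≤length x []      = z≤n
count≤≤length x (s ∷ S) = ≤-trans (count≤-∷ x s S) (s≤s (count≤≤length x S))

count≤-++ : ∀ x S R → count≤ x (S ++ R) ≡ count≤ x S + count≤ x R
count≤-++ x S R = trans (cong sum (map-++ [_≤ x ] S R)) (sum-++ (map [_≤ x ] S) (map [_≤ x ] R))

count≤-all : ∀ {x S} → All (_≤ x) S → count≤ x S ≡ length S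
count≤-all []                   = refl
count≤-all {x} {s ∷ _} (s≤x ∷ S≤x) with s ≤? x
... | yes _   = cong suc (count≤-all S≤x)
... | no  s≰x = ⊥-elim (s≰x s≤x)

count≤-none : ∀ {x S} → All (x <_) S → count≤ x S ≡ 0
count≤-none []                   = refl
count≤-none {x} {s ∷ _} (x<s ∷ x<S) with s ≤? x
... | yes s≤x = ⊥-elim (<⇒≱ x<s s≤x)
... | no  _   = count≤-none x<S

count≤-++-all : ∀ {x S} R → All (_≤ x) S → count≤ x (S ++ R) ≡ length S + count≤ x R
count≤-++-all {x} {S} R S≤x = trans (count≤-++ x S R) (cong (_+ count≤ x R) (count≤-all S≤x))

count≤-monoˡ : ∀ {x y} → x ≤ y → ∀ S → count≤ x S ≤ count≤ y S
count≤-monoˡ x≤y []               = z≤n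
count≤-monoˡ {x} {y} x≤y (s ∷ S) with s ≤? x | s ≤? y
... | yes _   | yes _   = s≤s (count≤-monoˡ x≤y S)
... | yes s≤x | no  s≰y = ⊥-elim (s≰y (≤-trans s≤x x≤y))
... | no  _   | yes _   = m≤n⇒m≤1+n (count≤-monoˡ x≤y S)
... | no  _   | no  _   = count≤-monoˡ x≤y S

count≤-antitone : ∀ {x S T} → Pointwise _≤_ S T → count≤ x T ≤ count≤ x S
count≤-antitone []                        = z≤n
count≤-antitone {x} (_∷_ {s} {t} s≤t S≤T) with t ≤? x | s ≤? x
... | yes _   | yes _   = s≤s (count≤-antitone S≤T)
... | yes t≤x | no  s≰x = ⊥-elim (s≰x (≤-trans s≤t t≤x))
... | no  _   | yes _   = m≤n⇒m≤1+n (count≤-antitone S≤T)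
... | no  _   | no  _   = count≤-antitone S≤T

count≤-drop : ∀ x m S → count≤ x S ≤ m + count≤ x (drop m S)
count≤-drop x zero    S       = ≤-refl
count≤-drop x (suc m) []      = z≤n
count≤-drop x (suc m) (s ∷ S) = ≤-trans (count≤-∷ x s S) (s≤s (count≤-drop x m S))

length≤count≤-++ : ∀ {x S} R → All (_≤ x) S → length S ≤ count≤ x (S ++ R)
length≤count≤-++ {x} {S} R S≤x = ≤-trans (m≤m+n (length S) _) (≤-reflexive (sym (count≤-++-all R S≤x)))

head+p≤ : ∀ {x s S} p → Linked _<_ (s ∷ S) → suc p ≤ count≤ x (s ∷ S) → s + p ≤ x
head+p≤ {x} {s} p sorted h with x <? s
... | yes x<s =
  ⊥-elim (<⇒≱ (s≤s z≤n) (≤-trans h (≤-reflexive (count≤-none (Linked⇒All <-trans x<s sorted)))))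
head+p≤ {x} {s} zero          _      _ | no x≮s = subst (_≤ x) (sym (+-identityʳ s)) (≮⇒≥ x≮s)
head+p≤ {x} {s} {[]}     (suc p) _      h | no _ =
  ⊥-elim (<⇒≱ (s≤s (s≤s z≤n)) (≤-trans h (count≤≤length x (s ∷ []))))
head+p≤ {x} {s} {s′ ∷ S} (suc p) sorted h | no _ = begin
  s + suc p ≡⟨ +-suc s p ⟩
  suc s + p ≤⟨ +-monoˡ-≤ p (Linked.head sorted) ⟩
  s′ + p    ≤⟨ head+p≤ p (Linked.tail sorted) (≤-pred (≤-trans h (count≤-∷ x s (s′ ∷ S)))) ⟩
  x         ∎
  where open ≤-Reasoning

pointwise-run-++⁺ : ∀ {x R} a p {S} → Linked _<_ S → p ≤ count≤ x S → x < a + p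
                 → Pointwise _≤_ (drop p S) R → Pointwise _≤_ S (run a p ++ R)
pointwise-run-++⁺ a zero          _      _ _     rest = rest
pointwise-run-++⁺ a (suc p) {[]}  _      () _    _
pointwise-run-++⁺ {x} a (suc p) {s ∷ S} sorted h x<end rest =
  s≤a ∷ pointwise-run-++⁺ (suc a) p (Linked.tail sorted) (≤-pred (≤-trans h (count≤-∷ x s S))) x<end′ rest
  where
  x<end′ : x < suc a + p
  x<end′ = subst (x <_) (+-suc a p) x<end
  s≤a : s ≤ a
  s≤a = +-cancelʳ-≤ p s a (≤-trans (head+p≤ p sorted h) (≤-pred x<end′))

module ThreeRuns (a p c r d q : ℕ) where

  A C D T : List ℕ
  A = run a (suc p)
  C = run c (suc r)
  D = run d (suc q)
  T = A ++ C ++ D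

  BlockCounts : ℕ → List ℕ → Set
  BlockCounts k S = suc p ≤ count≤ (a + p) S × suc p + suc r ≤ count≤ (c + r) S × k ≤ count≤ (d + q) S

  length-T : length T ≡ suc p + (suc r + suc q)
  length-T = begin
    length (A ++ C ++ D)              ≡⟨ length-++ A ⟩
    length A + length (C ++ D)        ≡⟨ cong (length A +_) (length-++ C) ⟩
    length A + (length C + length D)  ≡⟨ cong₂ _+_ (length-run a (suc p)) (cong₂ _+_ (length-run c (suc r)) (length-run d (suc q))) ⟩
    suc p + (suc r + suc q)           ∎
    where open ≡-Reasoning

  module _ (A<C : a + p < c) (C<D : c + r < d) where

    T≤end : All (_≤ d + q) T
    T≤end = All.++⁺ (All.map (λ x≤ → ≤-trans x≤ A≤e) (run-≤-end a p))
                    (All.++⁺ (All.map (λ x≤ → ≤-trans x≤ C≤e) (run-≤-end c r)) (run-≤-end d q))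
      where
      C≤e : c + r ≤ d + q
      C≤e = ≤-trans (<⇒≤ C<D) (m≤m+n d q)
      A≤e : a + p ≤ d + q
      A≤e = ≤-trans (<⇒≤ A<C) (≤-trans (m≤m+n c r) C≤e)

    counts-T : ∀ k → length T ≡ k → BlockCounts k T
    counts-T k |T| = countA , countAC , countT
      where
      countA : suc p ≤ count≤ (a + p) T
      countA = subst (_≤ count≤ (a + p) T) (length-run a (suc p)) (length≤count≤-++ (C ++ D) (run-≤-end a p))
      countAC : suc p + suc r ≤ count≤ (c + r) T
      countAC = begin
        suc p + suc r                       ≡⟨ sym (cong₂ _+_ (length-run a (suc p)) (length-run c (suc r))) ⟩
        length A + length C                 ≤⟨ +-monoʳ-≤ (length A) (length≤count≤-++ D (run-≤-end c r)) ⟩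
        length A + count≤ (c + r) (C ++ D)  ≡⟨ sym (count≤-++-all (C ++ D) A≤c) ⟩
        count≤ (c + r) T                    ∎
        where
        open ≤-Reasoning
        A≤c : All (_≤ c + r) A
        A≤c = All.map (λ x≤ → ≤-trans x≤ (≤-trans (<⇒≤ A<C) (m≤m+n c r))) (run-≤-end a p)
      countT : k ≤ count≤ (d + q) T
      countT = ≤-reflexive (trans (sym |T|) (sym (count≤-all T≤end)))

    pointwise⇒counts : ∀ {k S} → length T ≡ k → Pointwise _≤_ S T → BlockCounts k S
    pointwise⇒counts {k} |T| S≤T =
      let hA , hAC , hT = counts-T k |T|
      in  ≤-trans hA (count≤-antitone S≤T) , ≤-trans hAC (count≤-antitone S≤T)
        , ≤-trans hT (count≤-antitone S≤T)

  counts⇒pointwise : ∀ {k S} → length T ≡ k → Linked _<_ S → length S ≡ k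
                   → BlockCounts k S → Pointwise _≤_ S T
  counts⇒pointwise {k} {S} |T| sorted |S| (hA , hAC , hT) =
    pointwise-run-++⁺ a (suc p) sorted hA (end< a p)
      (pointwise-run-++⁺ c (suc r) sorted₁ hC (end< c r)
        (subst (Pointwise _≤_ S₂) (++-identityʳ D)
          (pointwise-run-++⁺ d (suc q) sorted₂ hD (end< d q)
            (subst (λ rest → Pointwise _≤_ rest []) (sym (drop-all (suc q) S₂ (≤-reflexive |S₂|))) []))))
    where
    S₁ = drop (suc p) S
    S₂ = drop (suc r) S₁
    sorted₁ : Linked _<_ S₁
    sorted₁ = Linked-drop (suc p) sorted
    sorted₂ : Linked _<_ S₂
    sorted₂ = Linked-drop (suc r) sorted₁
    end< : ∀ x m → x + m < x + suc m
    end< x m = +-monoʳ-< x (n<1+n m)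
    hC : suc r ≤ count≤ (c + r) S₁
    hC = +-cancelˡ-≤ (suc p) _ _ (≤-trans hAC (count≤-drop (c + r) (suc p) S))
    hD : suc q ≤ count≤ (d + q) S₂
    hD = +-cancelˡ-≤ (suc r) _ _ (+-cancelˡ-≤ (suc p) _ _ (begin
      suc p + (suc r + suc q)               ≡⟨ trans (sym length-T) |T| ⟩
      k                                     ≤⟨ hT ⟩
      count≤ (d + q) S                      ≤⟨ count≤-drop (d + q) (suc p) S ⟩
      suc p + count≤ (d + q) S₁             ≤⟨ +-monoʳ-≤ (suc p) (count≤-drop (d + q) (suc r) S₁) ⟩
      suc p + (suc r + count≤ (d + q) S₂)   ∎))
      where open ≤-Reasoning
    |S₂| : length S₂ ≡ suc q
    |S₂| = begin
      length S₂                               ≡⟨ length-drop (suc r) S₁ ⟩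
      length S₁ ∸ suc r                       ≡⟨ cong (_∸ suc r) (length-drop (suc p) S) ⟩
      length S ∸ suc p ∸ suc r                ≡⟨ cong (λ l → l ∸ suc p ∸ suc r) (trans |S| (trans (sym |T|) length-T)) ⟩
      suc p + (suc r + suc q) ∸ suc p ∸ suc r  ≡⟨ cong (_∸ suc r) (m+n∸m≡n (suc p) (suc r + suc q)) ⟩
      suc r + suc q ∸ suc r                   ≡⟨ m+n∸m≡n (suc r) (suc q) ⟩
      suc q                                   ∎
      where open ≡-Reasoning

  pointwise⇔counts : ∀ {k S} → a + p < c → c + r < d → length T ≡ k → Linked _<_ S → length S ≡ k
                   → Pointwise _≤_ S T ⇔ BlockCounts k S
  pointwise⇔counts A<C C<D |T| sorted |S| =
    mk⇔ (pointwise⇒counts A<C C<D |T|) (counts⇒pointwise |T| sorted |S|)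

module _ {k P X Y Z : ℕ} (M : ℕ) (kk≤M : k * suc k ≤ M) (X≤Y : X ≤ Y) (Y≤Z : Y ≤ Z) (Z≤k : Z ≤ k) where

  private
    Y≤k : Y ≤ k
    Y≤k = ≤-trans Y≤Z Z≤k
    X≤k : X ≤ k
    X≤k = ≤-trans X≤Y Y≤k

    gain-mono : ∀ {X′ Y′ Z′} → X ≤ X′ → Y ≤ Y′ → Z ≤ Z′ → k * X + Y + M * Z ≤ k * X′ + Y′ + M * Z′
    gain-mono x y z = +-mono-≤ (+-mono-≤ (*-monoʳ-≤ k x) y) (*-monoʳ-≤ M z)

    kP+kM≤loss : k * P + k * M ≤ X + k * (P + M)
    kP+kM≤loss = ≤-trans (≤-reflexive (sym (*-distribˡ-+ k P M))) (m≤n+m _ X)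

    gain≰loss : X + k * (P + M) < k * X + Y + M * Z → ¬ (k * X + Y + M * Z ≤ X + k * (P + M))
    gain≰loss = <⇒≱

  counts⇒inequality : P ≤ X × P + 1 ≤ Y × k ≤ Z → X + k * (P + M) < k * X + Y + M * Z
  counts⇒inequality (P≤X , P+1≤Y , k≤Z) with m≤n⇒∃[o]m+o≡n P≤X
  ... | t , P+t≡X = begin-strict
    X + k * (P + M)              ≡⟨ cong (_+ k * (P + M)) (sym P+t≡X) ⟩
    P + t + k * (P + M)          ≡⟨ regroup-loss k P M t ⟩
    k * P + M * k + (P + t)      <⟨ +-monoʳ-< (k * P + M * k) P+t<Y+k*t ⟩
    k * P + M * k + (Y + k * t)  ≡⟨ regroup-gain k P M t Y ⟩
    k * (P + t) + Y + M * k      ≡⟨ cong₂ (λ u v → k * u + Y + M * v) P+t≡X (≤-antisym k≤Z Z≤k) ⟩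
    k * X + Y + M * Z            ∎
    where
    open ≤-Reasoning
    regroup-loss : ∀ k P M t → P + t + k * (P + M) ≡ k * P + M * k + (P + t)
    regroup-loss = solve-∀
    regroup-gain : ∀ k P M t Y → k * P + M * k + (Y + k * t) ≡ k * (P + t) + Y + M * k
    regroup-gain = solve-∀
    0<k : 0 < k
    0<k = ≤-trans (≤-trans (m≤n+m 1 P) P+1≤Y) Y≤k
    P+t<Y+k*t : P + t < Y + k * t
    P+t<Y+k*t = +-mono-≤ (≤-trans (≤-reflexive (+-comm 1 P)) P+1≤Y) (m≤n*m t k {{>-nonZero 0<k}})

  inequality⇒k≤Z : X + k * (P + M) < k * X + Y + M * Z → k ≤ Z
  inequality⇒k≤Z loss<gain with k ≤? Z
  ... | yes k≤Z = k≤Z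
  ... | no  k≰Z = ⊥-elim (gain≰loss loss<gain (begin
    k * X + Y + M * Z       ≤⟨ gain-mono X≤k Y≤k ≤-refl ⟩
    k * k + k + M * Z       ≡⟨ cong (_+ M * Z) (trans (+-comm (k * k) k) (sym (*-suc k k))) ⟩
    k * suc k + M * Z       ≤⟨ +-monoˡ-≤ (M * Z) kk≤M ⟩
    M + M * Z               ≡⟨ *-suc M Z ⟨
    M * suc Z               ≤⟨ *-monoʳ-≤ M (≰⇒> k≰Z) ⟩
    M * k                   ≤⟨ ≤-trans (≤-reflexive (*-comm M k)) (m≤n+m (k * M) (k * P)) ⟩
    k * P + k * M           ≤⟨ kP+kM≤loss ⟩
    X + k * (P + M)         ∎))
    where open ≤-Reasoning

  inequality⇒P≤X : X + k * (P + M) < k * X + Y + M * Z → P ≤ X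
  inequality⇒P≤X loss<gain with P ≤? X
  ... | yes P≤X = P≤X
  ... | no  P≰X = ⊥-elim (gain≰loss loss<gain (begin
    k * X + Y + M * Z       ≤⟨ gain-mono ≤-refl Y≤k Z≤k ⟩
    k * X + k + M * k       ≡⟨ cong₂ _+_ (trans (+-comm (k * X) k) (sym (*-suc k X))) (*-comm M k) ⟩
    k * suc X + k * M       ≤⟨ +-monoˡ-≤ (k * M) (*-monoʳ-≤ k (≰⇒> P≰X)) ⟩
    k * P + k * M           ≤⟨ kP+kM≤loss ⟩
    X + k * (P + M)         ∎))
    where open ≤-Reasoning

  inequality⇒P+1≤Y : X + k * (P + M) < k * X + Y + M * Z → P + 1 ≤ Y
  inequality⇒P+1≤Y loss<gain with P + 1 ≤? Y
  ... | yes P+1≤Y = P+1≤Y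
  ... | no  P+1≰Y = ⊥-elim (gain≰loss loss<gain (begin
    k * X + Y + M * Z       ≤⟨ gain-mono (≤-trans X≤Y Y≤P) (≤-trans Y≤P (inequality⇒P≤X loss<gain)) Z≤k ⟩
    k * P + X + M * k       ≡⟨ regroup k P X M ⟩
    X + (k * P + k * M)     ≡⟨ cong (X +_) (*-distribˡ-+ k P M) ⟨
    X + k * (P + M)         ∎))
    where
    open ≤-Reasoning
    Y≤P : Y ≤ P
    Y≤P = ≤-pred (≤-trans (≰⇒> P+1≰Y) (≤-reflexive (+-comm P 1)))
    regroup : ∀ k P X M → k * P + X + M * k ≡ X + (k * P + k * M)
    regroup = solve-∀

  counts⇔inequality : (P ≤ X × P + 1 ≤ Y × k ≤ Z) ⇔ X + k * (P + M) < k * X + Y + M * Z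
  counts⇔inequality = mk⇔ counts⇒inequality
    (λ loss<gain → inequality⇒P≤X loss<gain , inequality⇒P+1≤Y loss<gain , inequality⇒k≤Z loss<gain)

sum-map-+ : ∀ (f g : ℕ → ℕ) xs → sum (map (λ x → f x + g x) xs) ≡ sum (map f xs) + sum (map g xs)
sum-map-+ f g []       = refl
sum-map-+ f g (x ∷ xs) = trans (cong (f x + g x +_) (sum-map-+ f g xs)) (interchange (f x) (g x) _ _)

sum-map-* : ∀ c (f : ℕ → ℕ) xs → sum (map (λ x → c * f x) xs) ≡ c * sum (map f xs)
sum-map-* c f []       = sym (*-zeroʳ c)
sum-map-* c f (x ∷ xs) = trans (cong (c * f x +_) (sum-map-* c f xs)) (sym (*-distribˡ-+ c (f x) _))

sum-map-const : ∀ c (xs : List ℕ) → sum (map (λ _ → c) xs) ≡ length xs * c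
sum-map-const c []       = refl
sum-map-const c (_ ∷ xs) = cong (c +_) (sum-map-const c xs)

⊖-+-⊖ : ∀ m n m′ n′ → (m ⊖ n) ℤ.+ (m′ ⊖ n′) ≡ (m + m′) ⊖ (n + n′)
⊖-+-⊖ m n m′ n′ = begin
  (m ⊖ n) ℤ.+ (m′ ⊖ n′)                          ≡⟨ sym (cong₂ ℤ._+_ ([+m]-[+n]≡m⊖n m n) ([+m]-[+n]≡m⊖n m′ n′)) ⟩
  (ℤ.+ m ℤ.- ℤ.+ n) ℤ.+ (ℤ.+ m′ ℤ.- ℤ.+ n′)      ≡⟨ regroup (ℤ.+ m) (ℤ.+ n) (ℤ.+ m′) (ℤ.+ n′) ⟩
  (ℤ.+ m ℤ.+ ℤ.+ m′) ℤ.- (ℤ.+ n ℤ.+ ℤ.+ n′)      ≡⟨ sym (cong₂ ℤ._-_ (ℤₚ.pos-+ m m′) (ℤₚ.pos-+ n n′)) ⟩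
  ℤ.+ (m + m′) ℤ.- ℤ.+ (n + n′)                  ≡⟨ [+m]-[+n]≡m⊖n (m + m′) (n + n′) ⟩
  (m + m′) ⊖ (n + n′)                            ∎
  where
  open ≡-Reasoning
  open ℤₚ using ([+m]-[+n]≡m⊖n)
  regroup : ∀ i j i′ j′ → (i ℤ.- j) ℤ.+ (i′ ℤ.- j′) ≡ (i ℤ.+ i′) ℤ.- (j ℤ.+ j′)
  regroup = ℤ-Solver.solve-∀

0<⊖⇔ : ∀ m n → ℤ.0ℤ ℤ.< m ⊖ n ⇔ n < m
0<⊖⇔ m n = mk⇔ to (λ n<m → subst (ℤ._< m ⊖ n) (ℤₚ.n⊖n≡0 n) (ℤₚ.⊖-monoˡ-< n n<m))
  where
  to : ℤ.0ℤ ℤ.< m ⊖ n → n < m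
  to 0<m⊖n with n <? m
  ... | yes n<m = n<m
  ... | no  n≮m = ⊥-elim (ℤₚ.<⇒≱ 0<m⊖n (subst (m ⊖ n ℤ.≤_) (ℤₚ.n⊖n≡0 n) (ℤₚ.⊖-monoˡ-≤ n (≮⇒≥ n≮m))))

fromℤ : ℤ → ℚ
fromℤ z = mkℚ z 0 (Coprime.sym (1-coprimeTo _))

fromℤ-+ : ∀ i j → fromℤ i ℚ.+ fromℤ j ≡ fromℤ (i ℤ.+ j)
fromℤ-+ i j = ℚₚ.toℚᵘ-injective (ℚᵘₚ.≃-trans (ℚₚ.toℚᵘ-homo-+ (fromℤ i) (fromℤ j)) (ℚᵘ.*≡* (cross-multiply i j)))
  where
  cross-multiply : ∀ i j → (i ℤ.* ℤ.1ℤ ℤ.+ j ℤ.* ℤ.1ℤ) ℤ.* ℤ.1ℤ ≡ (i ℤ.+ j) ℤ.* ℤ.1ℤ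
  cross-multiply = ℤ-Solver.solve-∀

0<fromℤ⇔ : ∀ z → ℚ.0ℚ ℚ.< fromℤ z ⇔ ℤ.0ℤ ℤ.< z
0<fromℤ⇔ z = mk⇔ (λ { (ℚ.*<* 0<z*1) → subst (ℤ.0ℤ ℤ.<_) (ℤₚ.*-identityʳ z) 0<z*1 })
                 (λ 0<z → ℚ.*<* (subst (ℤ.0ℤ ℤ.<_) (sym (ℤₚ.*-identityʳ z)) 0<z))

weight-⊖ : ∀ f g B → weight (λ x → fromℤ (f x ⊖ g x)) B ≡ fromℤ (sum (map f B) ⊖ sum (map g B))
weight-⊖ f g []      = refl
weight-⊖ f g (x ∷ B) = begin
  fromℤ (f x ⊖ g x) ℚ.+ weight (λ y → fromℤ (f y ⊖ g y)) B          ≡⟨ cong (fromℤ (f x ⊖ g x) ℚ.+_) (weight-⊖ f g B) ⟩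
  fromℤ (f x ⊖ g x) ℚ.+ fromℤ (sum (map f B) ⊖ sum (map g B))       ≡⟨ fromℤ-+ (f x ⊖ g x) _ ⟩
  fromℤ ((f x ⊖ g x) ℤ.+ (sum (map f B) ⊖ sum (map g B)))           ≡⟨ cong fromℤ (⊖-+-⊖ (f x) (g x) _ _) ⟩
  fromℤ ((f x + sum (map f B)) ⊖ (g x + sum (map g B)))             ∎
  where open ≡-Reasoning

module CountingWeight (k P b c e : ℕ) where

  M : ℕ
  M = k * suc k

  X Y Z : List ℕ → ℕ
  X = count≤ b
  Y = count≤ c
  Z = count≤ e

  gain loss : ℕ → ℕ
  gain x = k * [ x ≤ b ] + [ x ≤ c ] + M * [ x ≤ e ]
  loss x = [ x ≤ b ] + (P + M)

  w : ℕ → ℚ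
  w x = fromℤ (gain x ⊖ loss x)

  weight-w : ∀ B → length B ≡ k → weight w B ≡ fromℤ ((k * X B + Y B + M * Z B) ⊖ (X B + k * (P + M)))
  weight-w B |B| = trans (weight-⊖ gain loss B) (cong₂ (λ u v → fromℤ (u ⊖ v)) sum-gain sum-loss)
    where
    sum-gain : sum (map gain B) ≡ k * X B + Y B + M * Z B
    sum-gain = trans (sum-map-+ _ (λ x → M * [ x ≤ e ]) B)
                     (cong₂ _+_ (trans (sum-map-+ (λ x → k * [ x ≤ b ]) _ B) (cong (_+ Y B) (sum-map-* k _ B)))
                                (sum-map-* M _ B))
    sum-loss : sum (map loss B) ≡ X B + k * (P + M)
    sum-loss = trans (sum-map-+ _ (λ _ → P + M) B)
                     (cong (X B +_) (trans (sum-map-const (P + M) B) (cong (_* (P + M)) |B|)))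

  0<weight⇔ : ∀ B → length B ≡ k → (ℚ.0ℚ ℚ.< weight w B) ⇔ (X B + k * (P + M) < k * X B + Y B + M * Z B)
  0<weight⇔ B |B| rewrite weight-w B |B| = 0<fromℤ⇔ _ ⟨ ⇔.trans ⟩ 0<⊖⇔ _ _

three-runs-threshold : ∀ {n k} a p c d q T → T ≡ run a (suc p) ++ run c 1 ++ run d (suc q)
                     → KSubset n k T → IsThreshold n k (IsBasisOfShifted n k T)
three-runs-threshold {n} {k} a p c d q _ refl (sorted , _ , |T|) = w , basis⇔0<weight
  where
  open ThreeRuns a p c 0 d q
  open CountingWeight k (suc p) (a + p) (c + 0) (d + q)

  A<C : a + p < c
  A<C = run-++-end< a p sorted
  C<D : c + 0 < d
  C<D = run-++-end< c 0 (Linked-++⁻ʳ A sorted)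

  basis⇔0<weight : ∀ B → KSubset n k B → IsBasisOfShifted n k T B ⇔ (ℚ.0ℚ ℚ.< weight w B)
  basis⇔0<weight B B-subset@(sortedB , _ , |B|) =
    mk⇔ (λ { (_ , B≤T) → B≤T }) (B-subset ,_)
    ⟨ ⇔.trans ⟩ pointwise⇔counts A<C C<D |T| sortedB |B|
    ⟨ ⇔.trans ⟩ counts⇔inequality M ≤-refl (count≤-monoˡ (≤-trans (<⇒≤ A<C) (m≤m+n c 0)) B)
                  (count≤-monoˡ (≤-trans (<⇒≤ C<D) (m≤m+n d q)) B)
                  (≤-trans (count≤≤length (d + q) B) (≤-reflexive |B|))
    ⟨ ⇔.trans ⟩ ⇔.sym (0<weight⇔ B |B|)

lemma31 : (n k : ℕ) (T : List ℕ) → KSubset n k T → ¬ (1 ∈ T)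
          → (Σ (List ℕ) λ B₁ → Σ (List ℕ) λ B₂ → Σ (List ℕ) λ B₃ →
               blocks T ≡ B₁ ∷ B₂ ∷ B₃ ∷ [] × length B₂ ≡ 1)
          → IsThreshold n k (IsBasisOfShifted n k T)
lemma31 n k T T-subset _ (_ , _ , _ , blocks≡ , |B₂|) with three-blocks-shape blocks≡ |B₂|
... | a , p , c , d , q , T≡ = three-runs-threshold a p c d q T T≡ T-subset
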